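{- Let $p$ be an odd prime and let $k\ge 3$ be an integer, and let $p_1,\dots,p_{k-2}$ be positive integers with $\gcd(p_1,\dots,p_{k-2})=1$. For an integer $z$ with $1\le z\le p^2-1$ and $p\nmid z$, write $z=x+yp$ with $1\le x\le p-1$ and $0\le y\le p-1$, and for $1\le i\le p$ put $d^{z}_i=(i-1)xp+z$ and let $R^{p^3,z}_i\subseteq\mathbb{Z}_{p^3}$ be the set of residues modulo $p^3$ of $$d^z_i,\ p^2-d^z_i,\ p^2+d^z_i,\ 2p^2-d^z_i,\ 2p^2+d^z_i,\ \dots,\ (p-1)p^2-d^z_i,\ (p-1)p^2+d^z_i,\ p^3-d^z_i,$$ $$pp_1,\ \dots,\ pp_{k-2},\ p(p^3-p_{k-2}),\ \dots,\ p(p^3-p_1).$$ Then for every such $x,y$ and every $1\le i\le p$, $R^{p^3,\,p^2-x-yp}_i=R^{p^3,\,x+yp}_i$.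
   Context: All sets are subsets of $\mathbb{Z}_{p^3}$. Note that $p^2-x-yp=(p-x)+(p-1-y)p$, so the superscript $p^2-x-yp$ is decomposed with residue part $p-x$. -}

module Defs where

open import Data.Nat as ℕ using (ℕ; zero; suc; _∸_; NonZero)
open import Data.Nat.DivMod using (_%_)
open import Data.Nat.GCD using (gcd)
open import Data.Integer as ℤ using (ℤ; +_)
open import Data.Integer.Divisibility using (_∣_)
open import Data.Fin using (Fin)
open import Data.List using (List; map; upTo; allFin; _++_)
open import Data.List.Relation.Unary.Any using (Any)

gcdFin : ∀ {n} → (Fin n → ℕ) → ℕ
gcdFin {zero}  f = 0
gcdFin {suc n} f = gcd (f Fin.zero) (gcdFin (λ m → f (Fin.suc m)))
  where import Data.Fin as Fin

-- d^z_i = (i-1) x p + z, where x = z mod p is the residue part of z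
dval : (p : ℕ) → .{{NonZero p}} → (z i : ℕ) → ℕ
dval p z i = (i ∸ 1) ℕ.* (z % p) ℕ.* p ℕ.+ z

-- the integer representatives listed for R^{p^3,z}_i, with ps = (p₁,…,p_{k-2}):
--   j p² + d  (j = 0..p-1),   j p² - d  (j = 1..p),
--   p pₘ,   p (p³ - pₘ)
Rlist : (p : ℕ) → .{{NonZero p}} → ∀ {n} → (Fin n → ℕ) → (z i : ℕ) → List ℤ
Rlist p {n} ps z i =
     map (λ j → + (j ℕ.* p ℕ.^ 2) ℤ.+ + d) (upTo p)
  ++ map (λ j → + (suc j ℕ.* p ℕ.^ 2) ℤ.- + d) (upTo p)
  ++ map (λ m → + (p ℕ.* ps m)) (allFin n)
  ++ map (λ m → + p ℤ.* (+ (p ℕ.^ 3) ℤ.- + ps m)) (allFin n)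
  where d = dval p z i

-- membership of an integer a in the residue set R^{p^3,z}_i ⊆ ℤ_{p^3}:
-- a is congruent mod p³ to one of the listed representatives
InR : (p : ℕ) → .{{NonZero p}} → ∀ {n} → (Fin n → ℕ) → (z i : ℕ) → ℤ → Set
InR p ps z i a = Any (λ e → + (p ℕ.^ 3) ∣ (a ℤ.- e)) (Rlist p ps z i)

{-# OPTIONS --safe #-}
-- Modulo p³, the representatives j p² + d and (j + 1) p² − d (j < p) of R^{p³,z}_i are exactly
-- the integers congruent to d or to −d modulo p², and the multiples p pₘ, p (p³ − pₘ) do not
-- depend on z. For z′ = p² − z the residue parts x and p − x add up to p, so
-- d^{z′}_i + d^z_i = i p² ≡ 0 (mod p²): the two classes ±d are merely exchanged.
module Submission where

open import Defs
open import Data.Nat using (ℕ; _+_; _*_; _∸_; _^_; _≤_; _<_; NonZero)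
open import Data.Nat.Divisibility using (_∣_)
open import Data.Nat.Primality using (Prime)
open import Data.Integer using (ℤ)
open import Data.Fin using (Fin)
open import Relation.Nullary using (¬_)
open import Relation.Binary.PropositionalEquality using (_≡_)
open import Function.Bundles using (_⇔_)

import Data.Nat as ℕ
import Data.Nat.Properties as ℕ
import Data.Nat.DivMod as ℕ
import Data.Integer as ℤ
import Data.Integer.Properties as ℤ
open import Data.Integer.DivMod using (_%ℕ_; _/ℕ_; n%ℕd<d; a≡a%ℕn+[a/ℕn]*n)
import Data.Integer.Divisibility as ℤᵤ
open import Data.Integer.Divisibility.Signed as ℤₛ using (divides; ∣ᵤ⇒∣; ∣⇒∣ᵤ)
open import Data.Integer using (+_; -_)
open import Data.List using (List; map; upTo; allFin; _++_)
open import Data.List.Relation.Unary.Any using (Any)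
open import Data.List.Relation.Unary.Any.Properties using (map⁺; map⁻; ++↔)
open import Data.List.Membership.Propositional using (find; lose)
open import Data.List.Membership.Propositional.Properties using (∈-upTo⁺)
open import Data.Product using (_,_)
open import Data.Sum using (_⊎_; inj₁; inj₂)
open import Data.Sum.Algebra using (⊎-assoc)
open import Data.Sum.Function.Propositional using (_⊎-⇔_)
open import Function.Bundles using (mk⇔)
open import Function.Construct.Identity using (⇔-id)
open import Function.Construct.Symmetry using (⇔-sym)
open import Function.Construct.Composition using (_⇔-∘_)
open import Function.Related.Propositional using (module EquationalReasoning; equivalence)
open import Function.Properties.Inverse using (↔⇒⇔)
open import Relation.Binary.PropositionalEquality using (sym; trans; cong; cong₂; subst; module ≡-Reasoning)
import Data.Integer.Tactic.RingSolver as ℤ-Solver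
import Data.Nat.Tactic.RingSolver as ℕ-Solver

infix 4 _≡_⟨mod_⟩ _≡±_⟨mod_⟩

_≡_⟨mod_⟩ : ℤ → ℤ → ℤ → Set
a ≡ b ⟨mod k ⟩ = k ℤₛ.∣ a ℤ.- b

_≡±_⟨mod_⟩ : ℤ → ℤ → ℤ → Set
a ≡± d ⟨mod k ⟩ = a ≡ d ⟨mod k ⟩ ⊎ a ≡ - d ⟨mod k ⟩

mod-trans : ∀ {k a b c} → a ≡ b ⟨mod k ⟩ → b ≡ c ⟨mod k ⟩ → a ≡ c ⟨mod k ⟩
mod-trans {k} {a} {b} {c} a≡b b≡c =
  subst (k ℤₛ.∣_) (difference-split a b c) (ℤₛ.∣m∣n⇒∣m+n a≡b b≡c)
  where
  difference-split : ∀ a b c → (a ℤ.- b) ℤ.+ (b ℤ.- c) ≡ a ℤ.- c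
  difference-split = ℤ-Solver.solve-∀

mod-sym : ∀ {k a b} → a ≡ b ⟨mod k ⟩ → b ≡ a ⟨mod k ⟩
mod-sym {k} {a} {b} a≡b = subst (k ℤₛ.∣_) (negated-difference a b) (ℤₛ.∣m⇒∣-m a≡b)
  where
  negated-difference : ∀ a b → - (a ℤ.- b) ≡ b ℤ.- a
  negated-difference = ℤ-Solver.solve-∀

mod-cong-right : ∀ {k b c} → b ≡ c ⟨mod k ⟩ → ∀ a → a ≡ b ⟨mod k ⟩ ⇔ a ≡ c ⟨mod k ⟩
mod-cong-right {k} {b} {c} b≡c a =
  mk⇔ (λ a≡b → mod-trans {k} {a} a≡b b≡c) (λ a≡c → mod-trans {k} {a} a≡c (mod-sym {k} {b} b≡c))

mod-multiple : ∀ (q m c : ℤ) → q ℤ.* m ℤ.+ c ≡ c ⟨mod m ⟩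
mod-multiple q m c = divides q (shift q m c)
  where
  shift : ∀ q m c → q ℤ.* m ℤ.+ c ℤ.- c ≡ q ℤ.* m
  shift = ℤ-Solver.solve-∀

module _ (n m : ℕ) .{{_ : NonZero n}} (a c : ℤ) (f : ℕ → ℤ)
         (f-progression : ∀ j → f j ≡ + j ℤ.* + m ℤ.+ c) where

  any-progression⇔ : Any (λ e → + (n * m) ℤᵤ.∣ (a ℤ.- e)) (map f (upTo n)) ⇔ a ≡ c ⟨mod + m ⟩
  any-progression⇔ = mk⇔ to from
    where
    m∣nm : + m ℤₛ.∣ + (n * m)
    m∣nm = divides (+ n) (ℤ.pos-* n m)

    f≡c : ∀ j → f j ≡ c ⟨mod + m ⟩
    f≡c j = subst (λ e → e ≡ c ⟨mod + m ⟩) (sym (f-progression j)) (mod-multiple (+ j) (+ m) c)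

    to : Any (λ e → + (n * m) ℤᵤ.∣ (a ℤ.- e)) (map f (upTo n)) → a ≡ c ⟨mod + m ⟩
    to h with find (map⁻ h)
    ... | j , _ , nm∣ = mod-trans {+ m} {a} (ℤₛ.∣-trans m∣nm (∣ᵤ⇒∣ nm∣)) (f≡c j)

    -- a − c = t m is hit by the term with j = t mod n.
    from : a ≡ c ⟨mod + m ⟩ → Any (λ e → + (n * m) ℤᵤ.∣ (a ℤ.- e)) (map f (upTo n))
    from (divides t a-c≡tm) = map⁺ (lose (∈-upTo⁺ (n%ℕd<d t n)) (∣⇒∣ᵤ (divides (t /ℕ n) a-fj≡)))
      where
      open ≡-Reasoning
      j = t %ℕ n
      sub-sum : ∀ a b c → a ℤ.- (b ℤ.+ c) ≡ (a ℤ.- c) ℤ.- b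
      sub-sum = ℤ-Solver.solve-∀
      cancel-remainder : ∀ j q n m → (j ℤ.+ q ℤ.* n) ℤ.* m ℤ.- j ℤ.* m ≡ q ℤ.* (n ℤ.* m)
      cancel-remainder = ℤ-Solver.solve-∀
      a-fj≡ : a ℤ.- f j ≡ (t /ℕ n) ℤ.* + (n * m)
      a-fj≡ = begin
        a ℤ.- f j                              ≡⟨ cong (λ e → a ℤ.- e) (f-progression j) ⟩
        a ℤ.- (+ j ℤ.* + m ℤ.+ c)              ≡⟨ sub-sum a (+ j ℤ.* + m) c ⟩
        (a ℤ.- c) ℤ.- + j ℤ.* + m              ≡⟨ cong (λ s → s ℤ.- + j ℤ.* + m) a-c≡tm ⟩
        t ℤ.* + m ℤ.- + j ℤ.* + m              ≡⟨ cong (λ s → s ℤ.* + m ℤ.- + j ℤ.* + m) (a≡a%ℕn+[a/ℕn]*n t n) ⟩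
        (+ j ℤ.+ (t /ℕ n) ℤ.* + n) ℤ.* + m ℤ.- + j ℤ.* + m ≡⟨ cancel-remainder (+ j) (t /ℕ n) (+ n) (+ m) ⟩
        (t /ℕ n) ℤ.* (+ n ℤ.* + m)             ≡⟨ cong ((t /ℕ n) ℤ.*_) (ℤ.pos-* n m) ⟨
        (t /ℕ n) ℤ.* + (n * m)                 ∎

module _ {k d d′ : ℤ} (k∣d+d′ : k ℤₛ.∣ d ℤ.+ d′) (a : ℤ) where

  ≡±-swap : a ≡± d ⟨mod k ⟩ → a ≡± d′ ⟨mod k ⟩
  ≡±-swap (inj₁ a≡d)  = inj₂ (mod-trans {k} {a} a≡d (subst (k ℤₛ.∣_) (plus-as-minus d d′) k∣d+d′))
    where
    plus-as-minus : ∀ d d′ → d ℤ.+ d′ ≡ d ℤ.- - d′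
    plus-as-minus = ℤ-Solver.solve-∀
  ≡±-swap (inj₂ a≡-d) = inj₁ (mod-trans {k} {a} a≡-d (subst (k ℤₛ.∣_) (negated-sum d d′) (ℤₛ.∣m⇒∣-m k∣d+d′)))
    where
    negated-sum : ∀ d d′ → - (d ℤ.+ d′) ≡ - d ℤ.- d′
    negated-sum = ℤ-Solver.solve-∀

≡±-antipodal : ∀ {k d d′} → k ℤₛ.∣ d ℤ.+ d′ → ∀ a → a ≡± d ⟨mod k ⟩ ⇔ a ≡± d′ ⟨mod k ⟩
≡±-antipodal {k} {d} {d′} k∣d+d′ a =
  mk⇔ (≡±-swap k∣d+d′ a) (≡±-swap (subst (k ℤₛ.∣_) (ℤ.+-comm d d′) k∣d+d′) a)

module _ (p : ℕ) .{{_ : NonZero p}} {n : ℕ} (ps : Fin n → ℕ) (a : ℤ) where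

  private
    _≡_⟨mod-p³⟩ : ℤ → ℤ → Set
    b ≡ e ⟨mod-p³⟩ = + (p ^ 3) ℤᵤ.∣ (b ℤ.- e)

  plusRepresentatives : ℕ → List ℤ
  plusRepresentatives d = map (λ j → + (j * p ^ 2) ℤ.+ + d) (upTo p)

  minusRepresentatives : ℕ → List ℤ
  minusRepresentatives d = map (λ j → + (ℕ.suc j * p ^ 2) ℤ.- + d) (upTo p)

  multiplesOfP : List ℤ
  multiplesOfP = map (λ m → + (p * ps m)) (allFin n)
              ++ map (λ m → + p ℤ.* (+ (p ^ 3) ℤ.- + ps m)) (allFin n)

  any-plusRepresentatives⇔ : ∀ d → Any (a ≡_⟨mod-p³⟩) (plusRepresentatives d) ⇔ a ≡ + d ⟨mod + (p ^ 2) ⟩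
  any-plusRepresentatives⇔ d = any-progression⇔ p (p ^ 2) a (+ d) _ λ j → cong (ℤ._+ + d) (ℤ.pos-* j (p ^ 2))

  any-minusRepresentatives⇔ : ∀ d → Any (a ≡_⟨mod-p³⟩) (minusRepresentatives d) ⇔ a ≡ - + d ⟨mod + (p ^ 2) ⟩
  any-minusRepresentatives⇔ d =
    mod-cong-right (mod-multiple (+ 1) P² (- + d)) a ⇔-∘ any-progression⇔ p (p ^ 2) a (+ 1 ℤ.* P² ℤ.- + d) _ term
    where
    P² = + (p ^ 2)
    shift-out : ∀ j P D → (+ 1 ℤ.+ j) ℤ.* P ℤ.- D ≡ j ℤ.* P ℤ.+ (+ 1 ℤ.* P ℤ.- D)
    shift-out = ℤ-Solver.solve-∀
    term : ∀ j → + (ℕ.suc j * p ^ 2) ℤ.- + d ≡ + j ℤ.* P² ℤ.+ (+ 1 ℤ.* P² ℤ.- + d)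
    term j = trans (cong (ℤ._- + d) (ℤ.pos-* (ℕ.suc j) (p ^ 2))) (shift-out (+ j) P² (+ d))

  InR⇔ : ∀ z i → InR p ps z i a ⇔ (a ≡± + dval p z i ⟨mod + (p ^ 2) ⟩ ⊎ Any (a ≡_⟨mod-p³⟩) multiplesOfP)
  InR⇔ z i = begin
    InR p ps z i a
      ∼⟨ ⇔-sym (↔⇒⇔ ++↔) ⟩
    (Any (a ≡_⟨mod-p³⟩) (plusRepresentatives d) ⊎ Any (a ≡_⟨mod-p³⟩) (minusRepresentatives d ++ multiplesOfP))
      ∼⟨ ⇔-id _ ⊎-⇔ ⇔-sym (↔⇒⇔ ++↔) ⟩
    (Any (a ≡_⟨mod-p³⟩) (plusRepresentatives d) ⊎ (Any (a ≡_⟨mod-p³⟩) (minusRepresentatives d) ⊎ Any (a ≡_⟨mod-p³⟩) multiplesOfP))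
      ↔⟨ ⊎-assoc _ _ _ _ ⟨
    ((Any (a ≡_⟨mod-p³⟩) (plusRepresentatives d) ⊎ Any (a ≡_⟨mod-p³⟩) (minusRepresentatives d)) ⊎ Any (a ≡_⟨mod-p³⟩) multiplesOfP)
      ∼⟨ (any-plusRepresentatives⇔ d ⊎-⇔ any-minusRepresentatives⇔ d) ⊎-⇔ ⇔-id _ ⟩
    (a ≡± + d ⟨mod + (p ^ 2) ⟩ ⊎ Any (a ≡_⟨mod-p³⟩) multiplesOfP)
      ∎
    where
    open EquationalReasoning {k = equivalence}
    d = dval p z i

^2≡* : ∀ n → n ^ 2 ≡ n * n
^2≡* n = cong (n *_) (ℕ.*-identityʳ n)

module _ (p : ℕ) .{{_ : NonZero p}} where

  %-lowDigit : ∀ x y → x < p → (x + y * p) ℕ.% p ≡ x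
  %-lowDigit x y x<p = trans (ℕ.[m+kn]%n≡m%n x y p) (ℕ.m<n⇒m%n≡m x<p)

  -- i ≥ 1 is needed: at i = 0 the truncated factor i ∸ 1 is 0 and the sum is p², not 0.
  dval-antipodal : ∀ z z′ i → z ℕ.% p + z′ ℕ.% p ≡ p → z + z′ ≡ p ^ 2
                 → dval p z (ℕ.suc i) + dval p z′ (ℕ.suc i) ≡ ℕ.suc i * p ^ 2
  dval-antipodal z z′ i residues-sum sum = begin
    i * r * p + z + (i * r′ * p + z′) ≡⟨ regroup i r r′ p z z′ ⟩
    i * (r + r′) * p + (z + z′)       ≡⟨ cong₂ (λ s t → i * s * p + t) residues-sum sum ⟩
    i * p * p + p ^ 2                 ≡⟨ cong (λ s → i * p * p + s) (^2≡* p) ⟩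
    i * p * p + p * p                 ≡⟨ collect i p ⟩
    ℕ.suc i * (p * p)                 ≡⟨ cong (ℕ.suc i *_) (^2≡* p) ⟨
    ℕ.suc i * p ^ 2                   ∎
    where
    open ≡-Reasoning
    r = z ℕ.% p
    r′ = z′ ℕ.% p
    regroup : ∀ i r r′ p z z′ → i * r * p + z + (i * r′ * p + z′) ≡ i * (r + r′) * p + (z + z′)
    regroup = ℕ-Solver.solve-∀
    collect : ∀ i p → i * p * p + p * p ≡ (1 + i) * (p * p)
    collect = ℕ-Solver.solve-∀

module _ (q : ℕ) where

  private
    p = ℕ.suc q

  complementDigits : ∀ x y u v → x + u ≡ p → y + v ≡ q → (u + v * p) + (x + y * p) ≡ p ^ 2
  complementDigits x y u v x+u≡p y+v≡q = begin
    (u + v * p) + (x + y * p) ≡⟨ regroup x y u v p ⟩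
    (x + u) + (y + v) * p     ≡⟨ cong₂ (λ s t → s + t * p) x+u≡p y+v≡q ⟩
    p + q * p                 ≡⟨ square q ⟩
    p * p                     ≡⟨ ^2≡* p ⟨
    p ^ 2                     ∎
    where
    open ≡-Reasoning
    regroup : ∀ x y u v p → (u + v * p) + (x + y * p) ≡ (x + u) + (y + v) * p
    regroup = ℕ-Solver.solve-∀
    square : ∀ q → (1 + q) + q * (1 + q) ≡ (1 + q) * (1 + q)
    square = ℕ-Solver.solve-∀

  -- p² − x − y p has digits p − x and p − 1 − y in base p.
  dval-complement : ∀ x y i → 1 ≤ x → x ≤ q → y ≤ q
                  → dval p (p ^ 2 ∸ x ∸ y * p) (ℕ.suc i) + dval p (x + y * p) (ℕ.suc i) ≡ ℕ.suc i * p ^ 2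
  dval-complement x y i 1≤x x≤q y≤q =
    subst (λ w → dval p w (ℕ.suc i) + dval p z (ℕ.suc i) ≡ ℕ.suc i * p ^ 2) (sym z′≡)
      (dval-antipodal p (u + v * p) z i
        (trans (cong₂ _+_ (%-lowDigit p u v u<p) (%-lowDigit p x y x<p)) (trans (ℕ.+-comm u x) x+u≡p))
        digits-sum)
    where
    u = p ∸ x
    v = q ∸ y
    z = x + y * p
    x<p : x < p
    x<p = ℕ.s≤s x≤q
    u<p : u < p
    u<p = ℕ.∸-monoʳ-< 1≤x (ℕ.<⇒≤ x<p)
    x+u≡p : x + u ≡ p
    x+u≡p = ℕ.m+[n∸m]≡n (ℕ.<⇒≤ x<p)
    digits-sum : (u + v * p) + z ≡ p ^ 2
    digits-sum = complementDigits x y u v x+u≡p (ℕ.m+[n∸m]≡n y≤q)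
    z′≡ : p ^ 2 ∸ x ∸ y * p ≡ u + v * p
    z′≡ = trans (ℕ.∸-+-assoc (p ^ 2) x (y * p))
                (trans (cong (_∸ z) (sym digits-sum)) (ℕ.m+n∸n≡m (u + v * p) z))

lemma2p7 : (p : ℕ) → .{{_ : NonZero p}} → Prime p → ¬ (2 ∣ p)
    → (k : ℕ) → 3 ≤ k
    → (ps : Fin (k ∸ 2) → ℕ) → (∀ m → 0 < ps m) → gcdFin ps ≡ 1
    → (x y : ℕ) → 1 ≤ x → x ≤ p ∸ 1 → y ≤ p ∸ 1
    → (i : ℕ) → 1 ≤ i → i ≤ p
    → (a : ℤ) → InR p ps (p ^ 2 ∸ x ∸ y * p) i a ⇔ InR p ps (x + y * p) i a
lemma2p7 ℕ.zero _ _ _ _ _ _ _ (ℕ.suc _) _ _ () _ _ _ _ _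
lemma2p7 (ℕ.suc _) _ _ _ _ _ _ _ _ _ _ _ _ ℕ.zero () _ _
lemma2p7 p@(ℕ.suc q) _ _ _ _ ps _ _ x y 1≤x x≤q y≤q i@(ℕ.suc i′) _ _ a =
  ⇔-sym (InR⇔ p ps a z i) ⇔-∘ ((≡±-antipodal p²∣d′+d a ⊎-⇔ ⇔-id _) ⇔-∘ InR⇔ p ps a z′ i)
  where
  z = x + y * p
  z′ = p ^ 2 ∸ x ∸ y * p
  p²∣d′+d : + (p ^ 2) ℤₛ.∣ + dval p z′ i ℤ.+ + dval p z i
  p²∣d′+d = divides (+ i) (begin
    + dval p z′ i ℤ.+ + dval p z i ≡⟨ ℤ.pos-+ (dval p z′ i) (dval p z i) ⟨
    + (dval p z′ i + dval p z i)   ≡⟨ cong +_ (dval-complement q x y i′ 1≤x x≤q y≤q) ⟩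
    + (i * p ^ 2)                  ≡⟨ ℤ.pos-* i (p ^ 2) ⟩
    + i ℤ.* + (p ^ 2)              ∎)
    where open ≡-Reasoning
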